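{- Let $t\ge 3$ and let $\mathcal{H}$ be an $n$-vertex $3$-uniform hypergraph that does not contain $K_{2,t}$ as a trace. Let $A$ be the set of edges of $\mathcal{H}$ containing at least one pair $\{x,y\}$ with $d_{\mathcal{H}}(x,y)=1$, and let $B=\mathcal{H}\setminus A$. Fix a vertex $v$. Let $N_1(v)$ be the set of vertices $x$ such that some edge of $B$ contains $\{v,x\}$, and $N_2(v)$ the set of vertices $x\notin N_1(v)\cup\{v\}$ such that $x\in e$ for some edge $e\in B$ with $e\cap N_1(v)\neq\emptyset$. For $u\in N_1(v)$ let $E_u=\{e\in B: e\cap N_1(v)=\{u\}\}$ and $V_u=\{w\in N_2(v): w\in e \text{ for some } e\in E_u\}$. Then $$\sum_{u\in N_1(v)}|V_u|\le (t-1)(6t-2)\,n.$$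
   Context: A hypergraph $\mathcal{H}$ contains a graph $F$ (vertices $v_1,\ldots,v_p$, edges $e_1,\ldots,e_q$) as a trace if there exist distinct vertices $w_1,\ldots,w_p\in V(\mathcal{H})$ and distinct edges $f_1,\ldots,f_q\in E(\mathcal{H})$ such that whenever $e_i=v_\alpha v_\beta$ we have $f_i\cap\{w_1,\ldots,w_p\}=\{w_\alpha,w_\beta\}$. The co-degree $d_{\mathcal{H}}(x,y)$ is the number of edges of $\mathcal{H}$ containing $\{x,y\}$. $\mathcal{H}\setminus A$ denotes the hypergraph on $V(\mathcal{H})$ with edge set $E(\mathcal{H})\setminus A$. -}

module Defs where

open import Data.Nat using (ℕ; suc; _+_; _*_)
open import Data.Bool using (Bool; true; false; if_then_else_; not; _∧_; _∨_)
open import Data.Fin using (Fin; _↑ˡ_; _↑ʳ_; remQuot)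
import Data.Fin as Fin
open import Data.Fin.Subset using (Subset; _∈_; ∣_∣)
open import Data.Fin.Subset.Properties using (_∈?_)
open import Data.List using (List; length; filter; lookup; allFin; map)
open import Data.Nat.ListAction using (sum)
import Data.Bool.ListAction as BL
open import Data.List.Relation.Unary.All using (All)
open import Data.List.Relation.Unary.Unique.Propositional using (Unique)
open import Data.Product using (Σ; _×_; _,_; proj₁; proj₂)
open import Data.Sum using (_⊎_)
open import Relation.Nullary using (¬_)
open import Relation.Nullary.Decidable using (⌊_⌋)
open import Relation.Binary.PropositionalEquality using (_≡_)
open import Function.Definitions using (Injective)
open import Function.Bundles using (_⇔_)
import Data.Nat as ℕ

record Hypergraph3 (n : ℕ) : Set where
  field
    edges    : List (Subset n)
    distinct : Unique edges
    uniform  : All (λ e → ∣ e ∣ ≡ 3) edges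
open Hypergraph3 public

record Graph : Set where
  field
    p    : ℕ
    q    : ℕ
    edge : Fin q → Fin p × Fin p
open Graph public

-- H contains F as a trace (definition from the paper): distinct vertices w_α,
-- distinct edges f_i of H, with f_i ∩ {w_1..w_p} = {w_α, w_β} when e_i = v_α v_β.
ContainsTrace : ∀ {n} → Hypergraph3 n → Graph → Set
ContainsTrace {n} H F =
  Σ (Fin (p F) → Fin n) λ w → Injective _≡_ _≡_ w ×
  Σ (Fin (q F) → Fin (length (edges H))) λ f → Injective _≡_ _≡_ f ×
  (∀ i α → (w α ∈ lookup (edges H) (f i))
           ⇔ (α ≡ proj₁ (edge F i) ⊎ α ≡ proj₂ (edge F i)))

-- The complete bipartite graph K_{2,t}: vertices a_0,a_1 (= i ↑ˡ t) and
-- b_0..b_{t-1} (= 2 ↑ʳ j); edge k ↔ (i , j) = remQuot t k is a_i b_j.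
K2 : ℕ → Graph
K2 t = record
  { p = 2 + t
  ; q = 2 * t
  ; edge = λ k → let ij = remQuot {2} t k in
                 (proj₁ ij ↑ˡ t , 2 ↑ʳ proj₂ ij)
  }

_∈ᵇ_ : ∀ {n} → Fin n → Subset n → Bool
x ∈ᵇ e = ⌊ x ∈? e ⌋

_≟ᵇ_ : ∀ {n} → Fin n → Fin n → Bool
x ≟ᵇ y = ⌊ x Fin.≟ y ⌋

anyFin : ∀ {n} → (Fin n → Bool) → Bool
anyFin {n} P = BL.any P (allFin n)

anyIn : ∀ {A : Set} → List A → (A → Bool) → Bool
anyIn xs P = BL.any P xs

count : ∀ {n} → (Fin n → Bool) → ℕ
count {n} P = length (filter (λ x → P x Data.Bool.≟ true) (allFin n))

sumFin : ∀ {n} → (Fin n → ℕ) → ℕ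
sumFin {n} f = sum (map f (allFin n))

module Construction {n : ℕ} (H : Hypergraph3 n) where

  codeg : Fin n → Fin n → ℕ
  codeg x y = length (filter (λ e → ((x ∈ᵇ e) ∧ (y ∈ᵇ e)) Data.Bool.≟ true) (edges H))

  inA : Subset n → Bool
  inA e = anyFin λ x → anyFin λ y →
            not (x ≟ᵇ y) ∧ (x ∈ᵇ e) ∧ (y ∈ᵇ e) ∧ ⌊ codeg x y ℕ.≟ 1 ⌋

  B : List (Subset n)
  B = filter (λ e → not (inA e) Data.Bool.≟ true) (edges H)

  module AtVertex (v : Fin n) where

    N₁ : Fin n → Bool
    N₁ x = not (x ≟ᵇ v) ∧ anyIn B (λ e → (v ∈ᵇ e) ∧ (x ∈ᵇ e))

    N₂ : Fin n → Bool
    N₂ x = not (N₁ x) ∧ not (x ≟ᵇ v) ∧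
           anyIn B (λ e → (x ∈ᵇ e) ∧ anyFin (λ y → (y ∈ᵇ e) ∧ N₁ y))

    -- E_u = {e ∈ B : e ∩ N_1(v) = {u}}
    E : Fin n → List (Subset n)
    E u = filter (λ e → BL.all (λ y → ⌊ ((y ∈ᵇ e) ∧ N₁ y) Data.Bool.≟ (y ≟ᵇ u) ⌋) (allFin n)
                        Data.Bool.≟ true) B

    V : Fin n → Fin n → Bool
    V u w = N₂ w ∧ anyIn (E u) (λ e → w ∈ᵇ e)

    sumV : ℕ
    sumV = sumFin (λ u → if N₁ u then count (V u) else 0)

-- Fix w ∈ N₂(v) and let U be the set of u with w ∈ V_u. For u ∈ U pick an edge e_u ∈ E_u through w
-- and, since d(v,u) ≥ 2 while at most one edge contains v, u and w, an edge g_u = {v, u, y_u} missing w.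
-- If S ⊆ U has t elements and no u ∈ S has y_u ∈ S, then v, w and S with the edges g_u, e_u (u ∈ S)
-- form a trace of K_{2,t}: g_u meets them in {v, u}, and e_u in {w, u} because e_u ∩ N₁(v) = {u} and
-- v ∉ e_u. Such an S exists as soon as |U| ≥ t(t+1) (take a large fibre of y, or choose greedily),
-- so |U| < t(t+1), and double counting gives Σ_u |V_u| ≤ (t(t+1) − 1) n ≤ (t−1)(6t−2) n.
module Submission where

open import Defs
open import Algebra.Properties.CommutativeSemigroup using (interchange)
open import Data.Bool using (Bool; true; false; if_then_else_; not; _∧_; _∨_)
import Data.Bool as Bool
open import Data.Bool.Properties using (T-≡)
import Data.Bool.ListAction as BoolList
open import Data.Empty using (⊥-elim)
open import Data.Fin using (Fin; zero; suc; _↑ˡ_; _↑ʳ_; remQuot; combine)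
import Data.Fin as Fin
import Data.Fin.Properties as Finₚ
open import Data.Fin.Subset using (Subset; ∣_∣) renaming (_∈_ to _∈ₛ_)
open import Data.Fin.Subset.Properties using (_∈?_; ⊆-antisym)
open import Data.List using (List; []; _∷_; length; filter; lookup; allFin; map; tabulate)
open import Data.List.Properties using (map-cong; map-tabulate; length-tabulate; filter-some; filter-none)
open import Data.List.Membership.Propositional using (_∈_; lose; find)
open import Data.List.Membership.Propositional.Properties using (∈-allFin; ∈-filter⁻; ∈-lookup)
import Data.List.Relation.Unary.All as All
open import Data.List.Relation.Unary.All.Properties using (all⁺)
import Data.List.Relation.Unary.Any as Any
open import Data.List.Relation.Unary.Any.Properties using (any⁺; any⁻; lookup-index)
open import Data.List.Relation.Unary.AllPairs using (_∷_)
open import Data.List.Relation.Unary.Unique.Propositional using (Unique)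
open import Data.List.Relation.Unary.Unique.Propositional.Properties using (allFin⁺; filter⁺)
open import Data.Nat using (ℕ; zero; suc; _+_; _*_; _∸_; _≤_; _<_; z≤n; s≤s; _≤?_)
import Data.Nat as ℕ
open import Data.Nat.ListAction using (sum)
open import Data.Nat.Properties
open import Data.Nat.Solver using (module +-*-Solver)
open import Data.Product using (Σ; _×_; _,_; proj₁; proj₂; uncurry)
open import Data.Sum using (_⊎_; inj₁; inj₂)
open import Data.Vec using ([]; _∷_)
open import Function.Base using (_∘_)
open import Function.Bundles using (_⇔_; mk⇔; Equivalence)
open import Function.Definitions using (Injective)
open import Relation.Binary.PropositionalEquality
open import Relation.Nullary using (¬_; Dec; yes; no)
open import Relation.Nullary.Decidable using (⌊_⌋)

∧-true⁻ : ∀ {a b} → a ∧ b ≡ true → a ≡ true × b ≡ true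
∧-true⁻ {true} p = refl , p

∧-true⁺ : ∀ {a b} → a ≡ true → b ≡ true → a ∧ b ≡ true
∧-true⁺ refl refl = refl

not-true⁻ : ∀ {a} → not a ≡ true → a ≡ false
not-true⁻ {false} _ = refl

not-true⁺ : ∀ {a} → a ≡ false → not a ≡ true
not-true⁺ refl = refl

true≢false : ∀ {a} → a ≡ true → a ≢ false
true≢false refl ()

∨-true⁻ : ∀ {a b} → a ∨ b ≡ true → a ≡ true ⊎ b ≡ true
∨-true⁻ {true}  _ = inj₁ refl
∨-true⁻ {false} p = inj₂ p

∨-true⁺ˡ : ∀ {a} b → a ≡ true → a ∨ b ≡ true
∨-true⁺ˡ b refl = refl

∨-true⁺ʳ : ∀ a {b} → b ≡ true → a ∨ b ≡ true
∨-true⁺ʳ true  _ = refl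
∨-true⁺ʳ false p = p

module _ {P : Set} where

  isYes-true⁻ : (d : Dec P) → ⌊ d ⌋ ≡ true → P
  isYes-true⁻ (yes p) _ = p

  isYes-true⁺ : (d : Dec P) → P → ⌊ d ⌋ ≡ true
  isYes-true⁺ (yes _) _ = refl
  isYes-true⁺ (no ¬p) p = ⊥-elim (¬p p)

  isYes-false⁻ : (d : Dec P) → ⌊ d ⌋ ≡ false → ¬ P
  isYes-false⁻ (no ¬p) _ = ¬p

  isYes-false⁺ : (d : Dec P) → ¬ P → ⌊ d ⌋ ≡ false
  isYes-false⁺ (yes p) ¬p = ⊥-elim (¬p p)
  isYes-false⁺ (no _)  _  = refl

module _ {A : Set} (P : A → Bool) where

  any-true⁺ : ∀ {x xs} → x ∈ xs → P x ≡ true → BoolList.any P xs ≡ true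
  any-true⁺ x∈xs Px = Equivalence.to T-≡ (any⁺ P (lose x∈xs (Equivalence.from T-≡ Px)))

  any-true⁻ : ∀ xs → BoolList.any P xs ≡ true → Σ A λ x → x ∈ xs × P x ≡ true
  any-true⁻ xs h with find (any⁻ P xs (Equivalence.from T-≡ h))
  ... | x , x∈xs , Px = x , x∈xs , Equivalence.to T-≡ Px

  all-true⁻ : ∀ {x xs} → BoolList.all P xs ≡ true → x ∈ xs → P x ≡ true
  all-true⁻ {xs = xs} h x∈xs = Equivalence.to T-≡ (All.lookup (all⁺ P xs (Equivalence.from T-≡ h)) x∈xs)

𝟙 : Bool → ℕ
𝟙 b = if b then 1 else 0

𝟙-mono : ∀ {a b} → (a ≡ true → b ≡ true) → 𝟙 a ≤ 𝟙 b
𝟙-mono {false} _ = z≤n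
𝟙-mono {true}  h rewrite h refl = ≤-refl

𝟙-split : ∀ a b → 𝟙 a ≡ 𝟙 (a ∧ b) + 𝟙 (a ∧ not b)
𝟙-split true  true  = refl
𝟙-split true  false = refl
𝟙-split false _     = refl

module _ {A : Set} where

  sum-map-mono : ∀ (f g : A → ℕ) → (∀ x → f x ≤ g x) → ∀ xs → sum (map f xs) ≤ sum (map g xs)
  sum-map-mono f g f≤g []       = z≤n
  sum-map-mono f g f≤g (x ∷ xs) = +-mono-≤ (f≤g x) (sum-map-mono f g f≤g xs)

  sum-map-const : ∀ c (xs : List A) → sum (map (λ _ → c) xs) ≡ length xs * c
  sum-map-const c []       = refl
  sum-map-const c (x ∷ xs) = cong (c +_) (sum-map-const c xs)

  sum-map-≤ : ∀ (f : A → ℕ) M → (∀ x → f x ≤ M) → ∀ xs → sum (map f xs) ≤ length xs * M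
  sum-map-≤ f M f≤M xs = ≤-trans (sum-map-mono f (λ _ → M) f≤M xs) (≤-reflexive (sum-map-const M xs))

  sum-map-+ : ∀ (f g : A → ℕ) xs → sum (map (λ x → f x + g x) xs) ≡ sum (map f xs) + sum (map g xs)
  sum-map-+ f g []       = refl
  sum-map-+ f g (x ∷ xs) =
    trans (cong (f x + g x +_) (sum-map-+ f g xs)) (interchange +-commutativeSemigroup (f x) (g x) _ _)

  countIn : (A → Bool) → List A → ℕ
  countIn P xs = length (filter (λ x → P x Bool.≟ true) xs)

  countIn-∷ : ∀ (P : A → Bool) x xs → countIn P (x ∷ xs) ≡ 𝟙 (P x) + countIn P xs
  countIn-∷ P x xs with P x
  ... | true  = refl
  ... | false = refl

  countIn≡sum𝟙 : ∀ (P : A → Bool) xs → countIn P xs ≡ sum (map (𝟙 ∘ P) xs)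
  countIn≡sum𝟙 P []       = refl
  countIn≡sum𝟙 P (x ∷ xs) = trans (countIn-∷ P x xs) (cong (𝟙 (P x) +_) (countIn≡sum𝟙 P xs))

  countIn-mono : ∀ (P Q : A → Bool) → (∀ x → P x ≡ true → Q x ≡ true) → ∀ xs → countIn P xs ≤ countIn Q xs
  countIn-mono P Q P⇒Q xs = begin
    countIn P xs          ≡⟨ countIn≡sum𝟙 P xs ⟩
    sum (map (𝟙 ∘ P) xs)  ≤⟨ sum-map-mono _ _ (λ x → 𝟙-mono (P⇒Q x)) xs ⟩
    sum (map (𝟙 ∘ Q) xs)  ≡⟨ countIn≡sum𝟙 Q xs ⟨
    countIn Q xs          ∎
    where open ≤-Reasoning

  countIn-cong : ∀ (P Q : A → Bool) → (∀ x → P x ≡ Q x) → ∀ xs → countIn P xs ≡ countIn Q xs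
  countIn-cong P Q P≗Q xs = ≤-antisym (countIn-mono P Q (λ x → trans (sym (P≗Q x))) xs)
                                      (countIn-mono Q P (λ x → trans (P≗Q x)) xs)

  countIn-split : ∀ (P Q : A → Bool) xs →
    countIn P xs ≡ countIn (λ x → P x ∧ Q x) xs + countIn (λ x → P x ∧ not (Q x)) xs
  countIn-split P Q xs = begin
    countIn P xs
      ≡⟨ countIn≡sum𝟙 P xs ⟩
    sum (map (𝟙 ∘ P) xs)
      ≡⟨ cong sum (map-cong (λ x → 𝟙-split (P x) (Q x)) xs) ⟩
    sum (map (λ x → 𝟙 (P x ∧ Q x) + 𝟙 (P x ∧ not (Q x))) xs)
      ≡⟨ sum-map-+ _ _ xs ⟩
    sum (map (λ x → 𝟙 (P x ∧ Q x)) xs) + sum (map (λ x → 𝟙 (P x ∧ not (Q x))) xs)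
      ≡⟨ cong₂ _+_ (countIn≡sum𝟙 _ xs) (countIn≡sum𝟙 _ xs) ⟨
    countIn (λ x → P x ∧ Q x) xs + countIn (λ x → P x ∧ not (Q x)) xs ∎
    where open ≡-Reasoning

  countIn-pos⁺ : ∀ (P : A → Bool) {x xs} → x ∈ xs → P x ≡ true → 1 ≤ countIn P xs
  countIn-pos⁺ P x∈xs Px = filter-some (λ x → P x Bool.≟ true) (lose x∈xs Px)

  countIn-pos⁻ : ∀ (P : A → Bool) xs → 1 ≤ countIn P xs → Σ A λ x → x ∈ xs × P x ≡ true
  countIn-pos⁻ P xs pos with filter (λ x → P x Bool.≟ true) xs in eq
  countIn-pos⁻ P xs ()  | []
  countIn-pos⁻ P xs pos | y ∷ _ =
    y , ∈-filter⁻ (λ x → P x Bool.≟ true) (subst (y ∈_) (sym eq) (Any.here refl))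

  countIn-≤1 : ∀ (P : A → Bool) xs → Unique xs →
    (∀ {x y} → x ∈ xs → y ∈ xs → P x ≡ true → P y ≡ true → x ≡ y) → countIn P xs ≤ 1
  countIn-≤1 P []       _              _    = z≤n
  countIn-≤1 P (x ∷ xs) (x∉xs ∷ uniq) P-at-most-once with P x in Px
  ... | true  = s≤s (≤-reflexive (cong length (filter-none (λ x → P x Bool.≟ true)
                  (All.tabulate λ y∈xs Py → All.lookup x∉xs y∈xs
                    (P-at-most-once (Any.here refl) (Any.there y∈xs) Px Py)))))
  ... | false = countIn-≤1 P xs uniq (λ x∈ y∈ → P-at-most-once (Any.there x∈) (Any.there y∈))

module _ {A C : Set} where

  countIn-map : ∀ (P : C → Bool) (f : A → C) xs → countIn P (map f xs) ≡ countIn (P ∘ f) xs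
  countIn-map P f []       = refl
  countIn-map P f (x ∷ xs) = begin
    countIn P (f x ∷ map f xs)       ≡⟨ countIn-∷ P (f x) (map f xs) ⟩
    𝟙 (P (f x)) + countIn P (map f xs) ≡⟨ cong (𝟙 (P (f x)) +_) (countIn-map P f xs) ⟩
    𝟙 (P (f x)) + countIn (P ∘ f) xs   ≡⟨ countIn-∷ (P ∘ f) x xs ⟨
    countIn (P ∘ f) (x ∷ xs)         ∎
    where open ≡-Reasoning

  sum-countIn-transpose : ∀ (R : A → C → Bool) xs ys →
    sum (map (λ x → countIn (R x) ys) xs) ≡ sum (map (λ y → countIn (λ x → R x y) xs) ys)
  sum-countIn-transpose R [] ys = begin
    0                          ≡⟨ *-zeroʳ (length ys) ⟨
    length ys * 0              ≡⟨ sum-map-const 0 ys ⟨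
    sum (map (λ _ → 0) ys)     ∎
    where open ≡-Reasoning
  sum-countIn-transpose R (x ∷ xs) ys = begin
    countIn (R x) ys + sum (map (λ x → countIn (R x) ys) xs)
      ≡⟨ cong₂ _+_ (countIn≡sum𝟙 (R x) ys) (sum-countIn-transpose R xs ys) ⟩
    sum (map (𝟙 ∘ R x) ys) + sum (map (λ y → countIn (λ x → R x y) xs) ys)
      ≡⟨ sum-map-+ (𝟙 ∘ R x) (λ y → countIn (λ x → R x y) xs) ys ⟨
    sum (map (λ y → 𝟙 (R x y) + countIn (λ x → R x y) xs) ys)
      ≡⟨ cong sum (map-cong (λ y → sym (countIn-∷ (λ x → R x y) x xs)) ys) ⟩
    sum (map (λ y → countIn (λ x → R x y) (x ∷ xs)) ys) ∎
    where open ≡-Reasoning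

module _ {n : ℕ} where

  ∈ᵇ⇒∈ : ∀ {x : Fin n} {e} → x ∈ᵇ e ≡ true → x ∈ₛ e
  ∈ᵇ⇒∈ {x} {e} = isYes-true⁻ (x ∈? e)

  ∈⇒∈ᵇ : ∀ {x : Fin n} {e} → x ∈ₛ e → x ∈ᵇ e ≡ true
  ∈⇒∈ᵇ {x} {e} = isYes-true⁺ (x ∈? e)

  ∈ᵇ-false⇒∉ : ∀ {x : Fin n} {e} → x ∈ᵇ e ≡ false → ¬ x ∈ₛ e
  ∈ᵇ-false⇒∉ {x} {e} = isYes-false⁻ (x ∈? e)

  ≟ᵇ⇒≡ : ∀ {x y : Fin n} → x ≟ᵇ y ≡ true → x ≡ y
  ≟ᵇ⇒≡ {x} {y} = isYes-true⁻ (x Fin.≟ y)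

  ≟ᵇ-refl : ∀ (x : Fin n) → x ≟ᵇ x ≡ true
  ≟ᵇ-refl x = isYes-true⁺ (x Fin.≟ x) refl

  ≢⇒not-≟ᵇ : ∀ {x y : Fin n} → x ≢ y → not (x ≟ᵇ y) ≡ true
  ≢⇒not-≟ᵇ {x} {y} = not-true⁺ ∘ isYes-false⁺ (x Fin.≟ y)

  not-≟ᵇ⇒≢ : ∀ {x y : Fin n} → not (x ≟ᵇ y) ≡ true → x ≢ y
  not-≟ᵇ⇒≢ {x} {y} = isYes-false⁻ (x Fin.≟ y) ∘ not-true⁻

  count-≟ᵇ-≤1 : ∀ (P : Fin n → Bool) a → count (λ x → P x ∧ (x ≟ᵇ a)) ≤ 1
  count-≟ᵇ-≤1 P a = countIn-≤1 _ (allFin n) (allFin⁺ n)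
    λ _ _ Px Py → trans (≟ᵇ⇒≡ (proj₂ (∧-true⁻ Px))) (sym (≟ᵇ⇒≡ (proj₂ (∧-true⁻ Py))))

  count-remove : ∀ (P : Fin n → Bool) a {N} → suc N ≤ count P →
    N ≤ count (λ x → P x ∧ not (x ≟ᵇ a))
  count-remove P a {N} N<P = ≤-pred (begin
    suc N                                                    ≤⟨ N<P ⟩
    count P                                                  ≡⟨ countIn-split P (_≟ᵇ a) (allFin n) ⟩
    count (λ x → P x ∧ (x ≟ᵇ a)) + count (λ x → P x ∧ not (x ≟ᵇ a)) ≤⟨ +-monoˡ-≤ _ (count-≟ᵇ-≤1 P a) ⟩
    1 + count (λ x → P x ∧ not (x ≟ᵇ a))                     ∎)
    where open ≤-Reasoning

  count-insert : ∀ (P : Fin n → Bool) a {N} → P a ≡ true →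
    N ≤ count (λ x → P x ∧ not (x ≟ᵇ a)) → suc N ≤ count P
  count-insert P a {N} Pa N≤ = begin
    1 + N                                                    ≤⟨ +-mono-≤ a-counted N≤ ⟩
    count (λ x → P x ∧ (x ≟ᵇ a)) + count (λ x → P x ∧ not (x ≟ᵇ a)) ≡⟨ countIn-split P (_≟ᵇ a) (allFin n) ⟨
    count P                                                  ∎
    where
    open ≤-Reasoning
    a-counted : 1 ≤ count (λ x → P x ∧ (x ≟ᵇ a))
    a-counted = countIn-pos⁺ _ (∈-allFin a) (∧-true⁺ Pa (≟ᵇ-refl a))

∈ᵇ-suc : ∀ {n} b (e : Subset n) x → suc x ∈ᵇ (b ∷ e) ≡ x ∈ᵇ e
∈ᵇ-suc b e x with x ∈? e
... | yes _ = refl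
... | no _  = refl

count∈ᵇ-tail : ∀ {n} b (e : Subset n) → countIn (_∈ᵇ (b ∷ e)) (tabulate Fin.suc) ≡ count (_∈ᵇ e)
count∈ᵇ-tail {n} b e = begin
  countIn (_∈ᵇ (b ∷ e)) (tabulate Fin.suc)
    ≡⟨ cong (countIn (_∈ᵇ (b ∷ e))) (map-tabulate {n = n} (λ x → x) Fin.suc) ⟨
  countIn (_∈ᵇ (b ∷ e)) (map Fin.suc (allFin n))
    ≡⟨ countIn-map _ Fin.suc (allFin n) ⟩
  countIn (λ x → Fin.suc x ∈ᵇ (b ∷ e)) (allFin n)
    ≡⟨ countIn-cong _ _ (∈ᵇ-suc b e) (allFin n) ⟩
  count (_∈ᵇ e) ∎
  where open ≡-Reasoning

∣∣≡count∈ᵇ : ∀ {n} (e : Subset n) → ∣ e ∣ ≡ count (_∈ᵇ e)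
∣∣≡count∈ᵇ []          = refl
∣∣≡count∈ᵇ (true  ∷ e) = cong suc (trans (∣∣≡count∈ᵇ e) (sym (count∈ᵇ-tail true e)))
∣∣≡count∈ᵇ (false ∷ e) = trans (∣∣≡count∈ᵇ e) (sym (count∈ᵇ-tail false e))

Unique-lookup-injective : ∀ {A : Set} {xs : List A} → Unique xs → Injective _≡_ _≡_ (lookup xs)
Unique-lookup-injective {xs = _ ∷ _} _          {zero}  {zero}  _  = refl
Unique-lookup-injective {xs = _ ∷ _} (x∉xs ∷ _) {zero}  {suc j} eq = ⊥-elim (All.lookup x∉xs (∈-lookup j) eq)
Unique-lookup-injective {xs = _ ∷ _} (x∉xs ∷ _) {suc i} {zero}  eq = ⊥-elim (All.lookup x∉xs (∈-lookup i) (sym eq))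
Unique-lookup-injective {xs = _ ∷ _} (_ ∷ uniq) {suc i} {suc j} eq = cong suc (Unique-lookup-injective uniq eq)

enumerate : ∀ {n k} (S : Fin n → Bool) → k ≤ count S →
  Σ (Fin k → Fin n) λ s → Injective _≡_ _≡_ s × (∀ j → S (s j) ≡ true)
enumerate {n} S k≤∣S∣ = s , s-injective , s∈S
  where
  L : List (Fin n)
  L = filter (λ x → S x Bool.≟ true) (allFin n)
  s : _ → Fin n
  s j = lookup L (Fin.inject≤ j k≤∣S∣)
  s-injective : Injective _≡_ _≡_ s
  s-injective eq = Finₚ.inject≤-injective k≤∣S∣ k≤∣S∣ _ _
    (Unique-lookup-injective (filter⁺ (λ x → S x Bool.≟ true) (allFin⁺ n)) eq)
  s∈S : ∀ j → S (s j) ≡ true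
  s∈S j = proj₂ (∈-filter⁻ (λ x → S x Bool.≟ true) {xs = allFin n} (∈-lookup {xs = L} (Fin.inject≤ j k≤∣S∣)))

module _ {n : ℕ} {e : Subset n} (∣e∣≡3 : ∣ e ∣ ≡ 3) where

  private
    three≤count : 3 ≤ count (_∈ᵇ e)
    three≤count = ≤-reflexive (trans (sym ∣e∣≡3) (∣∣≡count∈ᵇ e))

  3-set-third : (a b : Fin n) → Σ (Fin n) λ c → c ∈ₛ e × c ≢ a × c ≢ b
  3-set-third a b with countIn-pos⁻ _ (allFin n) (count-remove _ b (count-remove (_∈ᵇ e) a three≤count))
  ... | c , _ , c-ok with ∧-true⁻ c-ok
  ... | c∈e∧c≢a , c≢b with ∧-true⁻ c∈e∧c≢a
  ... | c∈e , c≢a = c , ∈ᵇ⇒∈ c∈e , not-≟ᵇ⇒≢ c≢a , not-≟ᵇ⇒≢ c≢b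

  3-set-members : ∀ {a b c x} → a ≢ b → a ≢ c → b ≢ c →
    a ∈ₛ e → b ∈ₛ e → c ∈ₛ e → x ∈ₛ e → x ≡ a ⊎ x ≡ b ⊎ x ≡ c
  3-set-members {a} {b} {c} {x} a≢b a≢c b≢c a∈e b∈e c∈e x∈e with x Fin.≟ a | x Fin.≟ b | x Fin.≟ c
  ... | yes x≡a | _       | _       = inj₁ x≡a
  ... | no _    | yes x≡b | _       = inj₂ (inj₁ x≡b)
  ... | no _    | no _    | yes x≡c = inj₂ (inj₂ x≡c)
  ... | no x≢a  | no x≢b  | no x≢c  =
    ⊥-elim (<-irrefl refl (subst (4 ≤_) (trans (sym (∣∣≡count∈ᵇ e)) ∣e∣≡3) four≤count))
    where
    four≤count : 4 ≤ count (_∈ᵇ e)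
    four≤count =
      count-insert _ a (∈⇒∈ᵇ a∈e) (
      count-insert _ b (∧-true⁺ (∈⇒∈ᵇ b∈e) (≢⇒not-≟ᵇ (a≢b ∘ sym))) (
      count-insert _ c (∧-true⁺ (∧-true⁺ (∈⇒∈ᵇ c∈e) (≢⇒not-≟ᵇ (a≢c ∘ sym))) (≢⇒not-≟ᵇ (b≢c ∘ sym))) (
      countIn-pos⁺ _ (∈-allFin x)
        (∧-true⁺ (∧-true⁺ (∧-true⁺ (∈⇒∈ᵇ x∈e) (≢⇒not-≟ᵇ x≢a)) (≢⇒not-≟ᵇ x≢b)) (≢⇒not-≟ᵇ x≢c)))))

3-sets-≡ : ∀ {n} {e₁ e₂ : Subset n} {a b c} → ∣ e₁ ∣ ≡ 3 → ∣ e₂ ∣ ≡ 3 → a ≢ b → a ≢ c → b ≢ c →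
  a ∈ₛ e₁ → b ∈ₛ e₁ → c ∈ₛ e₁ → a ∈ₛ e₂ → b ∈ₛ e₂ → c ∈ₛ e₂ → e₁ ≡ e₂
3-sets-≡ {a = a} {b} {c} ∣e₁∣≡3 ∣e₂∣≡3 a≢b a≢c b≢c a∈e₁ b∈e₁ c∈e₁ a∈e₂ b∈e₂ c∈e₂ =
  ⊆-antisym (⊆ ∣e₁∣≡3 a∈e₁ b∈e₁ c∈e₁ a∈e₂ b∈e₂ c∈e₂) (⊆ ∣e₂∣≡3 a∈e₂ b∈e₂ c∈e₂ a∈e₁ b∈e₁ c∈e₁)
  where
  ⊆ : ∀ {e e′} → ∣ e ∣ ≡ 3 → a ∈ₛ e → b ∈ₛ e → c ∈ₛ e → a ∈ₛ e′ → b ∈ₛ e′ → c ∈ₛ e′ →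
      ∀ {x} → x ∈ₛ e → x ∈ₛ e′
  ⊆ ∣e∣≡3 a∈e b∈e c∈e a∈e′ b∈e′ c∈e′ x∈e with 3-set-members ∣e∣≡3 a≢b a≢c b≢c a∈e b∈e c∈e x∈e
  ... | inj₁ refl        = a∈e′
  ... | inj₂ (inj₁ refl) = b∈e′
  ... | inj₂ (inj₂ refl) = c∈e′

module _ {n : ℕ} (y : Fin n → Fin n) where

  Independent : (Fin n → Bool) → Set
  Independent S = ∀ {a b} → S a ≡ true → S b ≡ true → y a ≢ b

  FixpointFreeOn : (Fin n → Bool) → Set
  FixpointFreeOn P = ∀ {x} → P x ≡ true → y x ≢ x

  record IndependentSubset (P : Fin n → Bool) (k : ℕ) : Set where
    field
      S           : Fin n → Bool
      S⊆P         : ∀ {x} → S x ≡ true → P x ≡ true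
      k≤∣S∣       : k ≤ count S
      independent : Independent S

  fibre : (Fin n → Bool) → Fin n → Fin n → Bool
  fibre P u x = P x ∧ (y x ≟ᵇ u)

  fibre-independent : ∀ {P} → FixpointFreeOn P → ∀ u → Independent (fibre P u)
  fibre-independent fpf u {a} {b} a∈fibre b∈fibre ya≡b with ∧-true⁻ a∈fibre | ∧-true⁻ b∈fibre
  ... | _ , ya≡u | Pb , yb≡u = fpf Pb (trans (≟ᵇ⇒≡ yb≡u) (trans (sym (≟ᵇ⇒≡ ya≡u)) ya≡b))

  fibre-mono : ∀ P Q → (∀ {x} → P x ≡ true → Q x ≡ true) → ∀ u x → fibre P u x ≡ true → fibre Q u x ≡ true
  fibre-mono P Q P⊆Q u x h with P x in Px
  ... | true = subst (λ b → b ∧ (y x ≟ᵇ u) ≡ true) (sym (P⊆Q Px)) h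

  -- Choosing u for the independent set excludes u, y u and the at most d points of its
  -- fibre; this is where the factor 2 + d comes from.
  avoiding : (Fin n → Bool) → Fin n → Fin n → Bool
  avoiding P u x = ((P x ∧ not (x ≟ᵇ u)) ∧ not (x ≟ᵇ y u)) ∧ not (y x ≟ᵇ u)

  avoiding⁻ : ∀ P u {x} → avoiding P u x ≡ true → P x ≡ true × x ≢ u × x ≢ y u × y x ≢ u
  avoiding⁻ P u h with ∧-true⁻ h
  ... | h′ , yx≢u with ∧-true⁻ h′
  ... | h″ , x≢yu with ∧-true⁻ h″
  ... | Px , x≢u = Px , not-≟ᵇ⇒≢ x≢u , not-≟ᵇ⇒≢ x≢yu , not-≟ᵇ⇒≢ yx≢u

  count-avoiding : ∀ {d k} P u → (∀ u → count (fibre P u) ≤ d) →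
    suc k * (2 + d) ≤ count P → k * (2 + d) ≤ count (avoiding P u)
  count-avoiding {d} {k} P u small-fibres big =
    +-cancelˡ-≤ d _ _ (begin
      d + k * (2 + d)                                          ≤⟨ count-remove _ (y u) (count-remove P u big) ⟩
      count P₂                                                  ≡⟨ countIn-split P₂ (λ x → y x ≟ᵇ u) (allFin n) ⟩
      count (fibre P₂ u) + count (avoiding P u)                 ≤⟨ +-monoˡ-≤ _ fibre-part ⟩
      d + count (avoiding P u)                                  ∎)
    where
    open ≤-Reasoning
    P₂ : Fin n → Bool
    P₂ x = (P x ∧ not (x ≟ᵇ u)) ∧ not (x ≟ᵇ y u)
    fibre-part : count (fibre P₂ u) ≤ d
    fibre-part = ≤-trans (countIn-mono (fibre P₂ u) (fibre P u)
                   (fibre-mono P₂ P (λ h → proj₁ (∧-true⁻ (proj₁ (∧-true⁻ h)))) u) (allFin n)) (small-fibres u)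

  insert-independent : ∀ {P u k} → FixpointFreeOn P → P u ≡ true →
    IndependentSubset (avoiding P u) k → IndependentSubset P (suc k)
  insert-independent {P} {u} {k} fpf Pu I = record
    { S = S ; S⊆P = S⊆P ; k≤∣S∣ = k<∣S∣ ; independent = S-independent }
    where
    open IndependentSubset I renaming (S to S′; S⊆P to S′⊆; k≤∣S∣ to k≤∣S′∣; independent to S′-independent)
    S : Fin n → Bool
    S x = S′ x ∨ (x ≟ᵇ u)
    S-cases : ∀ {x} → S x ≡ true → S′ x ≡ true ⊎ x ≡ u
    S-cases {x} h with ∨-true⁻ {S′ x} h
    ... | inj₁ x∈S′ = inj₁ x∈S′
    ... | inj₂ x≡u  = inj₂ (≟ᵇ⇒≡ x≡u)
    S⊆P : ∀ {x} → S x ≡ true → P x ≡ true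
    S⊆P h with S-cases h
    ... | inj₁ x∈S′ = proj₁ (avoiding⁻ P u (S′⊆ x∈S′))
    ... | inj₂ refl = Pu
    S′⊆S∖u : ∀ x → S′ x ≡ true → (S x ∧ not (x ≟ᵇ u)) ≡ true
    S′⊆S∖u x x∈S′ = let _ , x≢u , _ = avoiding⁻ P u (S′⊆ x∈S′) in ∧-true⁺ (∨-true⁺ˡ _ x∈S′) (≢⇒not-≟ᵇ x≢u)
    k<∣S∣ : suc k ≤ count S
    k<∣S∣ = count-insert S u (∨-true⁺ʳ (S′ u) (≟ᵇ-refl u)) (≤-trans k≤∣S′∣ (countIn-mono S′ _ S′⊆S∖u (allFin n)))
    S-independent : Independent S
    S-independent a∈S b∈S with S-cases a∈S | S-cases b∈S
    ... | inj₁ a∈S′ | inj₁ b∈S′ = S′-independent a∈S′ b∈S′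
    ... | inj₁ a∈S′ | inj₂ refl = let _ , _ , _ , ya≢u = avoiding⁻ P u (S′⊆ a∈S′) in ya≢u
    ... | inj₂ refl | inj₁ b∈S′ = let _ , _ , b≢yu , _ = avoiding⁻ P u (S′⊆ b∈S′) in b≢yu ∘ sym
    ... | inj₂ refl | inj₂ refl = fpf Pu

  greedy-independent-subset : ∀ {d} k P → FixpointFreeOn P → (∀ u → count (fibre P u) ≤ d) →
    k * (2 + d) ≤ count P → IndependentSubset P k
  greedy-independent-subset zero P _ _ _ = record
    { S = λ _ → false ; S⊆P = λ () ; k≤∣S∣ = z≤n ; independent = λ () }
  greedy-independent-subset (suc k) P fpf small-fibres big with countIn-pos⁻ P (allFin n) (≤-trans (s≤s z≤n) big)
  ... | u , _ , Pu = insert-independent fpf Pu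
        (greedy-independent-subset k (avoiding P u) (fpf ∘ proj₁ ∘ avoiding⁻ P u)
          (λ w → ≤-trans (countIn-mono (fibre (avoiding P u) w) (fibre P w)
                   (fibre-mono (avoiding P u) P (proj₁ ∘ avoiding⁻ P u) w) (allFin n)) (small-fibres w))
          (count-avoiding {k = k} P u small-fibres big))

  -- Either some fibre of y has d + 1 elements (fibres are independent as y has no fixed
  -- points), or all fibres are small and the greedy choice succeeds.
  independent-subset : ∀ d P → FixpointFreeOn P → suc d * (2 + d) ≤ count P → IndependentSubset P (suc d)
  independent-subset d P fpf big with Finₚ.any? (λ u → suc d ≤? count (fibre P u))
  ... | yes (u , large-fibre) = record
    { S = fibre P u ; S⊆P = proj₁ ∘ ∧-true⁻ ; k≤∣S∣ = large-fibre ; independent = fibre-independent fpf u }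
  ... | no no-large-fibre =
    greedy-independent-subset (suc d) P fpf (λ u → ≤-pred (≰⇒> (no-large-fibre ∘ (u ,_)))) big

K2-endpoint : ∀ {t} → Fin 2 → Fin t → Fin (2 + t) → Set
K2-endpoint {t} a j α = α ≡ a ↑ˡ t ⊎ α ≡ 2 ↑ʳ j

↑ˡ≢↑ʳ : ∀ {t} (a : Fin 2) (j : Fin t) → a ↑ˡ t ≢ 2 ↑ʳ j
↑ˡ≢↑ʳ zero       j ()
↑ˡ≢↑ʳ (suc zero) j ()

K2-endpoints-injective : ∀ {t} {a a′ : Fin 2} {j j′ : Fin t} →
  (∀ α → K2-endpoint a j α → K2-endpoint a′ j′ α) → (a , j) ≡ (a′ , j′)
K2-endpoints-injective {t} {a} {a′} {j} {j′} ⊆ = cong₂ _,_ a≡a′ j≡j′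
  where
  a≡a′ : a ≡ a′
  a≡a′ with ⊆ (a ↑ˡ t) (inj₁ refl)
  ... | inj₁ eq = Finₚ.↑ˡ-injective t a a′ eq
  ... | inj₂ eq = ⊥-elim (↑ˡ≢↑ʳ a j′ eq)
  j≡j′ : j ≡ j′
  j≡j′ with ⊆ (2 ↑ʳ j) (inj₂ refl)
  ... | inj₁ eq = ⊥-elim (↑ˡ≢↑ʳ a′ j (sym eq))
  ... | inj₂ eq = Finₚ.↑ʳ-injective 2 j j′ eq

K2-trace : ∀ {n} (H : Hypergraph3 n) t (w : Fin (2 + t) → Fin n) → Injective _≡_ _≡_ w →
  (f : Fin 2 → Fin t → Subset n) → (∀ a j → f a j ∈ edges H) →
  (∀ a j α → (w α ∈ₛ f a j) ⇔ K2-endpoint a j α) → ContainsTrace H (K2 t)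
K2-trace H t w w-injective f f∈H f-trace = w , w-injective , index , index-injective , index-trace
  where
  edgeOf : Fin (2 * t) → Fin 2 × Fin t
  edgeOf = remQuot t

  index : Fin (2 * t) → Fin (length (edges H))
  index i = Any.index (f∈H (proj₁ (edgeOf i)) (proj₂ (edgeOf i)))

  index-trace : ∀ i α → (w α ∈ₛ lookup (edges H) (index i)) ⇔ K2-endpoint (proj₁ (edgeOf i)) (proj₂ (edgeOf i)) α
  index-trace i α = subst (λ e → (w α ∈ₛ e) ⇔ K2-endpoint a j α) (lookup-index (f∈H a j)) (f-trace a j α)
    where
    a : Fin 2
    a = proj₁ (edgeOf i)
    j : Fin t
    j = proj₂ (edgeOf i)

  index-injective : Injective _≡_ _≡_ index
  index-injective {i} {i′} eq = begin
    i                          ≡⟨ Finₚ.combine-remQuot t i ⟨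
    uncurry combine (edgeOf i)  ≡⟨ cong (uncurry combine) (K2-endpoints-injective endpoints⊆) ⟩
    uncurry combine (edgeOf i′) ≡⟨ Finₚ.combine-remQuot t i′ ⟩
    i′                         ∎
    where
    open ≡-Reasoning
    endpoints⊆ : ∀ α → K2-endpoint (proj₁ (edgeOf i)) (proj₂ (edgeOf i)) α →
                       K2-endpoint (proj₁ (edgeOf i′)) (proj₂ (edgeOf i′)) α
    endpoints⊆ α endpoint = Equivalence.to (index-trace i′ α)
      (subst (λ k → w α ∈ₛ lookup (edges H) k) eq (Equivalence.from (index-trace i α) endpoint))

module _ {n : ℕ} (H : Hypergraph3 n) where
  open Construction H

  edge-size : ∀ {e} → e ∈ edges H → ∣ e ∣ ≡ 3
  edge-size = All.lookup (uniform H)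

  ∈B⁻ : ∀ {e} → e ∈ B → e ∈ edges H × inA e ≡ false
  ∈B⁻ e∈B with ∈-filter⁻ (λ e → not (inA e) Bool.≟ true) e∈B
  ... | e∈H , e∉A = e∈H , not-true⁻ e∉A

  inA⁺ : ∀ {e x y} → x ≢ y → x ∈ₛ e → y ∈ₛ e → codeg x y ≡ 1 → inA e ≡ true
  inA⁺ {e} {x} {y} x≢y x∈e y∈e codeg≡1 =
    any-true⁺ (λ x → anyFin λ y → not (x ≟ᵇ y) ∧ (x ∈ᵇ e) ∧ (y ∈ᵇ e) ∧ ⌊ codeg x y ℕ.≟ 1 ⌋) (∈-allFin x)
      (any-true⁺ (λ y → not (x ≟ᵇ y) ∧ (x ∈ᵇ e) ∧ (y ∈ᵇ e) ∧ ⌊ codeg x y ℕ.≟ 1 ⌋) (∈-allFin y)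
        (∧-true⁺ (≢⇒not-≟ᵇ x≢y) (∧-true⁺ (∈⇒∈ᵇ x∈e) (∧-true⁺ (∈⇒∈ᵇ y∈e) (isYes-true⁺ (codeg x y ℕ.≟ 1) codeg≡1)))))

  B-codeg≥2 : ∀ {e x y} → e ∈ B → x ≢ y → x ∈ₛ e → y ∈ₛ e → 2 ≤ codeg x y
  B-codeg≥2 {e} {x} {y} e∈B x≢y x∈e y∈e with ∈B⁻ e∈B
  ... | e∈H , e∉A = ≤∧≢⇒< (countIn-pos⁺ _ e∈H (∧-true⁺ (∈⇒∈ᵇ x∈e) (∈⇒∈ᵇ y∈e))) codeg≢1
    where
    codeg≢1 : 1 ≢ codeg x y
    codeg≢1 1≡codeg = true≢false (inA⁺ x≢y x∈e y∈e (sym 1≡codeg)) e∉A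

  module _ (v : Fin n) where
    open AtVertex v

    N₁⁺ : ∀ {u f} → u ≢ v → f ∈ B → v ∈ₛ f → u ∈ₛ f → N₁ u ≡ true
    N₁⁺ {u} u≢v f∈B v∈f u∈f =
      ∧-true⁺ (≢⇒not-≟ᵇ u≢v) (any-true⁺ (λ e → (v ∈ᵇ e) ∧ (u ∈ᵇ e)) f∈B (∧-true⁺ (∈⇒∈ᵇ v∈f) (∈⇒∈ᵇ u∈f)))

    N₁⁻ : ∀ {u} → N₁ u ≡ true → u ≢ v × Σ (Subset n) λ f → f ∈ B × v ∈ₛ f × u ∈ₛ f
    N₁⁻ {u} h with ∧-true⁻ h
    ... | u≢v , some-f with any-true⁻ (λ e → (v ∈ᵇ e) ∧ (u ∈ᵇ e)) B some-f
    ... | f , f∈B , vu∈f with ∧-true⁻ vu∈f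
    ... | v∈f , u∈f = not-≟ᵇ⇒≢ u≢v , f , f∈B , ∈ᵇ⇒∈ v∈f , ∈ᵇ⇒∈ u∈f

    N₂⁻ : ∀ {w} → N₂ w ≡ true → N₁ w ≡ false × w ≢ v
    N₂⁻ h with ∧-true⁻ h
    ... | w∉N₁ , h′ = not-true⁻ w∉N₁ , not-≟ᵇ⇒≢ (proj₁ (∧-true⁻ h′))

    E⁻ : ∀ {u e} → e ∈ E u →
      e ∈ B × u ∈ₛ e × N₁ u ≡ true × (∀ {x} → x ∈ₛ e → N₁ x ≡ true → x ≡ u)
    E⁻ {u} {e} e∈Eu with ∈-filter⁻ (λ e → BoolList.all (λ y → ⌊ ((y ∈ᵇ e) ∧ N₁ y) Bool.≟ (y ≟ᵇ u) ⌋) (allFin n)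
                                             Bool.≟ true) e∈Eu
    ... | e∈B , all-ok = e∈B , ∈ᵇ⇒∈ (proj₁ u∈e∧u∈N₁) , proj₂ u∈e∧u∈N₁ ,
                         λ x∈e x∈N₁ → ≟ᵇ⇒≡ (trans (sym (e∩N₁ _)) (∧-true⁺ (∈⇒∈ᵇ x∈e) x∈N₁))
      where
      e∩N₁ : ∀ x → ((x ∈ᵇ e) ∧ N₁ x) ≡ (x ≟ᵇ u)
      e∩N₁ x = isYes-true⁻ (((x ∈ᵇ e) ∧ N₁ x) Bool.≟ (x ≟ᵇ u))
        (all-true⁻ (λ y → ⌊ ((y ∈ᵇ e) ∧ N₁ y) Bool.≟ (y ≟ᵇ u) ⌋) all-ok (∈-allFin x))
      u∈e∧u∈N₁ : u ∈ᵇ e ≡ true × N₁ u ≡ true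
      u∈e∧u∈N₁ = ∧-true⁻ (trans (e∩N₁ u) (≟ᵇ-refl u))

    V⁻ : ∀ {u w} → V u w ≡ true → N₂ w ≡ true × Σ (Subset n) λ e → e ∈ E u × w ∈ₛ e
    V⁻ {u} {w} h with ∧-true⁻ h
    ... | w∈N₂ , some-e with any-true⁻ (w ∈ᵇ_) (E u) some-e
    ... | e , e∈Eu , w∈e = w∈N₂ , e , e∈Eu , ∈ᵇ⇒∈ w∈e

    edge-through-avoiding : ∀ {u w} → N₁ u ≡ true → w ≢ v → w ≢ u →
      Σ (Subset n) λ g → g ∈ edges H × v ∈ₛ g × u ∈ₛ g × ¬ w ∈ₛ g
    edge-through-avoiding {u} {w} u∈N₁ w≢v w≢u with N₁⁻ u∈N₁
    ... | u≢v , f , f∈B , v∈f , u∈f with countIn-pos⁻ (λ e → Pvu e ∧ not (w ∈ᵇ e)) (edges H) one≤avoiding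
      where
      Pvu : Subset n → Bool
      Pvu e = (v ∈ᵇ e) ∧ (u ∈ᵇ e)
      members : ∀ {e} → (Pvu e ∧ (w ∈ᵇ e)) ≡ true → v ∈ₛ e × u ∈ₛ e × w ∈ₛ e
      members h with ∧-true⁻ h
      ... | vu∈e , w∈e with ∧-true⁻ vu∈e
      ... | v∈e , u∈e = ∈ᵇ⇒∈ v∈e , ∈ᵇ⇒∈ u∈e , ∈ᵇ⇒∈ w∈e
      at-most-one : countIn (λ e → Pvu e ∧ (w ∈ᵇ e)) (edges H) ≤ 1
      at-most-one = countIn-≤1 _ (edges H) (distinct H) λ e₁∈H e₂∈H h₁ h₂ →
        let v∈e₁ , u∈e₁ , w∈e₁ = members h₁
            v∈e₂ , u∈e₂ , w∈e₂ = members h₂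
        in 3-sets-≡ (edge-size e₁∈H) (edge-size e₂∈H) (u≢v ∘ sym) (w≢v ∘ sym) (w≢u ∘ sym)
                    v∈e₁ u∈e₁ w∈e₁ v∈e₂ u∈e₂ w∈e₂
      one≤avoiding : 1 ≤ countIn (λ e → Pvu e ∧ not (w ∈ᵇ e)) (edges H)
      one≤avoiding = ≤-pred (begin
        2                                                      ≤⟨ B-codeg≥2 f∈B (u≢v ∘ sym) v∈f u∈f ⟩
        codeg v u                                              ≡⟨ countIn-split Pvu (w ∈ᵇ_) (edges H) ⟩
        countIn (λ e → Pvu e ∧ (w ∈ᵇ e)) (edges H)
          + countIn (λ e → Pvu e ∧ not (w ∈ᵇ e)) (edges H)   ≤⟨ +-monoˡ-≤ _ at-most-one ⟩
        1 + countIn (λ e → Pvu e ∧ not (w ∈ᵇ e)) (edges H)   ∎)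
        where open ≤-Reasoning
    ... | g , g∈H , h with ∧-true⁻ h
    ... | vu∈g , w∉g with ∧-true⁻ vu∈g
    ... | v∈g , u∈g = g , g∈H , ∈ᵇ⇒∈ v∈g , ∈ᵇ⇒∈ u∈g , ∈ᵇ-false⇒∉ (not-true⁻ w∉g)

    record Witness (w u y : Fin n) : Set where
      field
        e g    : Subset n
        e∈H    : e ∈ edges H
        g∈H    : g ∈ edges H
        u∈N₁   : N₁ u ≡ true
        u≢v    : u ≢ v
        u≢w    : u ≢ w
        w∈e    : w ∈ₛ e
        u∈e    : u ∈ₛ e
        v∉e    : ¬ v ∈ₛ e
        e∩N₁⊆u : ∀ {x} → x ∈ₛ e → N₁ x ≡ true → x ≡ u
        v∈g    : v ∈ₛ g
        u∈g    : u ∈ₛ g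
        w∉g    : ¬ w ∈ₛ g
        y≢u    : y ≢ u
        g⊆vuy  : ∀ {x} → x ∈ₛ g → x ≡ v ⊎ x ≡ u ⊎ x ≡ y

    witness : ∀ {u w} → V u w ≡ true → Σ (Fin n) (Witness w u)
    witness {u} {w} Vuw =
      let w∈N₂ , e , e∈Eu , w∈e              = V⁻ Vuw
          w∉N₁ , w≢v                         = N₂⁻ w∈N₂
          e∈B , u∈e , u∈N₁ , e∩N₁⊆u          = E⁻ e∈Eu
          u≢v , _                            = N₁⁻ u∈N₁
          u≢w : u ≢ w
          u≢w = λ { refl → true≢false u∈N₁ w∉N₁ }
          g , g∈H , v∈g , u∈g , w∉g          = edge-through-avoiding u∈N₁ w≢v (u≢w ∘ sym)
          y , y∈g , y≢v , y≢u                = 3-set-third (edge-size g∈H) v u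
      in y , record
        { e = e ; g = g ; e∈H = proj₁ (∈B⁻ e∈B) ; g∈H = g∈H ; u∈N₁ = u∈N₁ ; u≢v = u≢v ; u≢w = u≢w
        ; w∈e = w∈e ; u∈e = u∈e ; v∉e = λ v∈e → true≢false (N₁⁺ w≢v e∈B v∈e w∈e) w∉N₁
        ; e∩N₁⊆u = e∩N₁⊆u ; v∈g = v∈g ; u∈g = u∈g ; w∉g = w∉g ; y≢u = y≢u
        ; g⊆vuy = 3-set-members (edge-size g∈H) (u≢v ∘ sym) (y≢v ∘ sym) (y≢u ∘ sym) v∈g u∈g y∈g }

    partner-choice : ∀ w u → Σ (Fin n) λ y → V u w ≡ true → Witness w u y
    partner-choice w u with V u w in Vuw
    ... | true  = proj₁ (witness Vuw) , λ _ → proj₂ (witness Vuw)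
    ... | false = u , λ ()

    partner : Fin n → Fin n → Fin n
    partner w u = proj₁ (partner-choice w u)

    partner-witness : ∀ {w u} → V u w ≡ true → Witness w u (partner w u)
    partner-witness {w} {u} = proj₂ (partner-choice w u)

    independent-witnesses⇒trace : ∀ {w t} (y : Fin n → Fin n) (S : Fin n → Bool) → w ≢ v →
      (∀ {u} → S u ≡ true → Witness w u (y u)) → Independent y S → t ≤ count S → ContainsTrace H (K2 t)
    independent-witnesses⇒trace {w} {t} y S w≢v witness-of S-independent t≤∣S∣ =
      K2-trace H t W W-injective f f∈H f-trace
      where
      s : Fin t → Fin n
      s = proj₁ (enumerate S t≤∣S∣)
      s-injective : Injective _≡_ _≡_ s
      s-injective = proj₁ (proj₂ (enumerate S t≤∣S∣))
      s∈S : ∀ j → S (s j) ≡ true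
      s∈S = proj₂ (proj₂ (enumerate S t≤∣S∣))
      module Wit (j : Fin t) = Witness (witness-of (s∈S j))

      W : Fin (2 + t) → Fin n
      W zero          = v
      W (suc zero)    = w
      W (suc (suc j)) = s j

      W-injective : Injective _≡_ _≡_ W
      W-injective {zero}        {zero}        _  = refl
      W-injective {zero}        {suc zero}    eq = ⊥-elim (w≢v (sym eq))
      W-injective {zero}        {suc (suc k)} eq = ⊥-elim (Wit.u≢v k (sym eq))
      W-injective {suc zero}    {zero}        eq = ⊥-elim (w≢v eq)
      W-injective {suc zero}    {suc zero}    _  = refl
      W-injective {suc zero}    {suc (suc k)} eq = ⊥-elim (Wit.u≢w k (sym eq))
      W-injective {suc (suc j)} {zero}        eq = ⊥-elim (Wit.u≢v j eq)
      W-injective {suc (suc j)} {suc zero}    eq = ⊥-elim (Wit.u≢w j eq)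
      W-injective {suc (suc j)} {suc (suc k)} eq = cong (Fin.suc ∘ Fin.suc) (s-injective eq)

      f : Fin 2 → Fin t → Subset n
      f zero       j = Wit.g j
      f (suc zero) j = Wit.e j

      f∈H : ∀ a j → f a j ∈ edges H
      f∈H zero       j = Wit.g∈H j
      f∈H (suc zero) j = Wit.e∈H j

      g-trace : ∀ j k → s k ∈ₛ Wit.g j → k ≡ j
      g-trace j k sk∈g with Wit.g⊆vuy j sk∈g
      ... | inj₁ sk≡v        = ⊥-elim (Wit.u≢v k sk≡v)
      ... | inj₂ (inj₁ sk≡sj) = s-injective sk≡sj
      ... | inj₂ (inj₂ sk≡y)  = ⊥-elim (S-independent (s∈S j) (s∈S k) (sym sk≡y))

      f-trace : ∀ a j α → (W α ∈ₛ f a j) ⇔ K2-endpoint a j α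
      f-trace zero j zero = mk⇔ (λ _ → inj₁ refl) (λ _ → Wit.v∈g j)
      f-trace zero j (suc zero) = mk⇔ (⊥-elim ∘ Wit.w∉g j) λ { (inj₁ ()) ; (inj₂ ()) }
      f-trace zero j (suc (suc k)) = mk⇔ (λ sk∈g → inj₂ (cong (Fin.suc ∘ Fin.suc) (g-trace j k sk∈g)))
                                         λ { (inj₁ ()) ; (inj₂ refl) → Wit.u∈g j }
      f-trace (suc zero) j zero = mk⇔ (⊥-elim ∘ Wit.v∉e j) λ { (inj₁ ()) ; (inj₂ ()) }
      f-trace (suc zero) j (suc zero) = mk⇔ (λ _ → inj₁ refl) (λ _ → Wit.w∈e j)
      f-trace (suc zero) j (suc (suc k)) =
        mk⇔ (λ sk∈e → inj₂ (cong (Fin.suc ∘ Fin.suc) (s-injective (Wit.e∩N₁⊆u j sk∈e (Wit.u∈N₁ k)))))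
            λ { (inj₁ ()) ; (inj₂ refl) → Wit.u∈e j }

    V-column-bound : ∀ d → ¬ ContainsTrace H (K2 (suc d)) → ∀ w → count (λ u → V u w) < suc d * (2 + d)
    V-column-bound d no-trace w with suc d * (2 + d) ≤? count (λ u → V u w)
    ... | no small = ≰⇒> small
    ... | yes big with countIn-pos⁻ (λ u → V u w) (allFin n) (≤-trans (s≤s z≤n) big)
    ... | u₀ , _ , Vu₀w = ⊥-elim (no-trace
          (independent-witnesses⇒trace (partner w) S w≢v (partner-witness ∘ S⊆P) independent k≤∣S∣))
      where
      open IndependentSubset (independent-subset (partner w) d (λ u → V u w) (Witness.y≢u ∘ partner-witness) big)
      open Witness (partner-witness Vu₀w) using (e; w∈e; v∉e)
      w≢v : w ≢ v
      w≢v w≡v = v∉e (subst (_∈ₛ e) w≡v w∈e)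

if-then-0-≤ : ∀ (b : Bool) m → (if b then m else 0) ≤ m
if-then-0-≤ true  m = ≤-refl
if-then-0-≤ false m = z≤n

t[t+1]≤1+[t∸1][6t∸2] : ∀ m → (2 + m) * (3 + m) ≤ suc ((1 + m) * (6 * (2 + m) ∸ 2))
t[t+1]≤1+[t∸1][6t∸2] m = subst ((2 + m) * (3 + m) ≤_) (sym (expand m)) (m≤m+n _ _)
  where
  open +-*-Solver
  expand : ∀ m → suc ((1 + m) * (m + 5 * (2 + m))) ≡ (2 + m) * (3 + m) + (5 + m * (11 + 5 * m))
  expand = solve 1 (λ m → con 1 :+ (con 1 :+ m) :* (m :+ con 5 :* (con 2 :+ m))
                          := (con 2 :+ m) :* (con 3 :+ m) :+ (con 5 :+ m :* (con 11 :+ con 5 :* m))) refl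

mainTheorem7 : (t n : ℕ) → 3 ≤ t → (H : Hypergraph3 n) →
    ¬ ContainsTrace H (K2 t) → (v : Fin n) →
    Construction.AtVertex.sumV H v ≤ (t ∸ 1) * (6 * t ∸ 2) * n
mainTheorem7 (suc (suc (suc k))) n (s≤s (s≤s (s≤s z≤n))) H no-trace v = begin
  sumV
    ≤⟨ sum-map-mono _ (λ u → count (V u)) (λ u → if-then-0-≤ (N₁ u) _) (allFin n) ⟩
  sum (map (λ u → count (V u)) (allFin n))
    ≡⟨ sum-countIn-transpose V (allFin n) (allFin n) ⟩
  sum (map (λ w → count (λ u → V u w)) (allFin n))
    ≤⟨ sum-map-≤ _ M column-bound (allFin n) ⟩
  length (allFin n) * M
    ≡⟨ cong (_* M) (length-tabulate {n = n} (λ x → x)) ⟩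
  n * M
    ≡⟨ *-comm n M ⟩
  M * n ∎
  where
  open ≤-Reasoning
  open Construction H
  open AtVertex v
  M : ℕ
  M = (2 + k) * (6 * (3 + k) ∸ 2)
  column-bound : ∀ w → count (λ u → V u w) ≤ M
  column-bound w = ≤-pred (≤-trans (V-column-bound H v (2 + k) no-trace w) (t[t+1]≤1+[t∸1][6t∸2] (suc k)))
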